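{- Let $T$ be any Erdős–Szekeres tableau of size $n$. Then $[T]=L(P(T))$, i.e. a linear order on $[n]$ arises from a sequence $A$ with $T(A)=T$ if and only if it is a linear extension of the order poset $P(T)$.
   Context: For a sequence $A=(a_1,\dots,a_n)$ of distinct real numbers, let $a_i^+$ (resp. $a_i^-$) be the length of the longest increasing (resp. decreasing) subsequence of $A$ ending at $a_i$; the Erdős–Szekeres tableau (EST) of $A$ is $T(A)=((a_i^+,a_i^-))_{i\le n}$. $\mathcal{T}_n$ is the set of all ESTs of sequences of length $n$. A sequence $A$ is identified with the linear order $<_A$ on $[n]=\{1,\dots,n\}$ given by $i<_A j$ iff $a_i<a_j$. For $T\in\mathcal{T}_n$, $[T]$ is the set of linear orders $<_A$ on $[n]$ with $T(A)=T$. The order poset $P(T)=([n],<_{P(T)})$ is defined by $i<_{P(T)}j$ iff $i<_A j$ for all $A\in[T]$. For a poset $P$ on a set $X$, $L(P)$ is the set of linear orders on $X$ extending $<_P$. -}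

module Defs where

open import Data.Nat using (ℕ; suc; _≤_)
open import Data.Fin using (Fin; fromℕ) renaming (_<_ to _<ᶠ_)
open import Data.Fin.Permutation using (Permutation′; _⟨$⟩ʳ_)
open import Data.Product using (Σ; Σ-syntax; ∃; ∃-syntax; _×_; proj₁; proj₂)
open import Relation.Binary.PropositionalEquality using (_≡_)

-- A linear order on [n] = Fin n is represented by a permutation π
-- (its rank function): i <_π j  iff  π i < π j.  The sequence
-- A = (π 0, …, π (n-1)) of distinct numbers induces exactly this order,
-- and every sequence of distinct reals induces such an order.
LinOrd : ℕ → Set
LinOrd n = Permutation′ n

module _ {n : ℕ} where

  _<[_]_ : Fin n → LinOrd n → Fin n → Set
  i <[ π ] j = (π ⟨$⟩ʳ i) <ᶠ (π ⟨$⟩ʳ j)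

  IncStep : LinOrd n → Fin n → Fin n → Set
  IncStep π j i = (j <ᶠ i) × (j <[ π ] i)

  DecStep : LinOrd n → Fin n → Fin n → Set
  DecStep π j i = (j <ᶠ i) × (i <[ π ] j)

  -- a subsequence of length (suc m) along R ending at position i:
  -- indices s 0, …, s m with s m = i
  -- (R is required between every pair p < q of the subsequence)
  ChainEndingAt : (Fin n → Fin n → Set) → Fin n → ℕ → Set
  ChainEndingAt R i m =
    Σ[ s ∈ (Fin (suc m) → Fin n) ]
      ((∀ p q → p <ᶠ q → R (s p) (s q)) × (s (fromℕ m) ≡ i))

  LongestEndingAt : (Fin n → Fin n → Set) → Fin n → ℕ → Set
  LongestEndingAt R i k =
    Σ[ m ∈ ℕ ] ((k ≡ suc m) × ChainEndingAt R i m ×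
                 (∀ m′ → ChainEndingAt R i m′ → m′ ≤ m))

-- A tableau of size n: the list of pairs (a_i^+, a_i^-).
Tableau : ℕ → Set
Tableau n = Fin n → ℕ × ℕ

HasEST : {n : ℕ} → LinOrd n → Tableau n → Set
HasEST π T = ∀ i → LongestEndingAt (IncStep π) i (proj₁ (T i))
                 × LongestEndingAt (DecStep π) i (proj₂ (T i))

IsEST : {n : ℕ} → Tableau n → Set
IsEST {n} T = ∃[ π ] HasEST {n} π T

InClass : {n : ℕ} → Tableau n → LinOrd n → Set
InClass T π = HasEST π T

_<P[_]_ : {n : ℕ} → Fin n → Tableau n → Fin n → Set
_<P[_]_ {n} i T j = (π : LinOrd n) → HasEST π T → i <[ π ] j

IsLinearExtension : {n : ℕ} → Tableau n → LinOrd n → Set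
IsLinearExtension T π = ∀ i j → i <P[ T ] j → i <[ π ] j

module Submission where

-- One inclusion is the definition of P(T).  For the other,
-- treat the two coordinates of T separately: a_i^+ is the longest-chain
-- function of the step relation "earlier and <_A-smaller", a_i^- that of
-- "earlier and <_A-larger".  Both are instances of one situation: a family
-- of strict total orders L ρ on positions and a function f on positions.
--
-- Chains of a transitive relation can be extended by one
--      point at the end and shortened by dropping their last point.
--   2. Gradings.  f is the longest-chain function of a transitive R iff it
--      is a grading: positive, strictly R-monotone, and every value k+2 is
--      reached from an R-predecessor of value k+1.
--   3. Forcing.  Fix a nonempty class C of orders ρ on which f grades the
--      step relation of L ρ.  Then "later position, no larger value" is
--      forced L-below, and the latest earlier position with value k+1 is
--      forced L-below a position of value k+2.  Hence every order extending
--      the relations forced in C is again graded by f.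
-- Applying 3 to both coordinates with C = [T] gives the theorem.

open import Defs
open import Data.Nat as ℕ using (ℕ; zero; suc; _≤_; z≤n; s≤s)
import Data.Nat.Properties as ℕP
open import Data.Fin using (Fin; fromℕ; inject₁; lower₁; toℕ)
  renaming (_<_ to _<ᶠ_; _>_ to _>ᶠ_)
import Data.Fin.Properties as FP
open import Data.Fin.Induction using (>-wellFounded)
open import Data.Fin.Permutation using (_⟨$⟩ʳ_)
open import Data.Product using (∃-syntax; _×_; _,_; proj₁; proj₂)
open import Data.Sum using (_⊎_; inj₁; inj₂)
open import Data.Empty using (⊥-elim)
open import Function using (_∘_; flip)
open import Function.Bundles using (Injection)
open import Function.Properties.Inverse using (↔⇒↣)
open import Induction.WellFounded using (Acc; acc)
open import Level using (0ℓ)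
open import Relation.Binary using (Rel; Transitive; Trichotomous; tri<; tri≈; tri>)
open import Relation.Binary.Consequences using (tri⇒asym)
import Relation.Binary.Construct.Flip.EqAndOrd as Flip
open import Relation.Nullary using (¬_; yes; no)
open import Relation.Nullary.Decidable using (_×-dec_)
open import Relation.Unary using (Pred; Decidable)
open import Relation.Binary.PropositionalEquality

lastOrInject : ∀ {m} (p : Fin (suc m)) → p ≡ fromℕ m ⊎ ∃[ q ] p ≡ inject₁ q
lastOrInject {m} p with m ℕ.≟ toℕ p
... | yes m≡p = inj₁ (FP.toℕ-injective (trans (sym m≡p) (sym (FP.toℕ-fromℕ m))))
... | no m≢p  = inj₂ (lower₁ p m≢p , sym (FP.inject₁-lower₁ p m≢p))

inject₁-mono : ∀ {m} {p q : Fin m} → p <ᶠ q → inject₁ p <ᶠ inject₁ q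
inject₁-mono {p = p} {q} =
  subst₂ ℕ._<_ (sym (FP.toℕ-inject₁ p)) (sym (FP.toℕ-inject₁ q))

inject₁-mono⁻¹ : ∀ {m} {p q : Fin m} → inject₁ p <ᶠ inject₁ q → p <ᶠ q
inject₁-mono⁻¹ {p = p} {q} = subst₂ ℕ._<_ (FP.toℕ-inject₁ p) (FP.toℕ-inject₁ q)

inject₁<fromℕ : ∀ {m} (p : Fin m) → inject₁ p <ᶠ fromℕ m
inject₁<fromℕ {m} p =
  subst₂ ℕ._<_ (sym (FP.toℕ-inject₁ p)) (sym (FP.toℕ-fromℕ m)) (FP.toℕ<n p)

_∷ʳ_ : ∀ {A : Set} {m} → (Fin m → A) → A → Fin (suc m) → A
(s ∷ʳ a) p with lastOrInject p
... | inj₁ _       = a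
... | inj₂ (q , _) = s q

∷ʳ-last : ∀ {A : Set} {m} (s : Fin m → A) a → (s ∷ʳ a) (fromℕ m) ≡ a
∷ʳ-last {m = m} s a with lastOrInject (fromℕ m)
... | inj₁ _       = refl
... | inj₂ (_ , e) = ⊥-elim (FP.fromℕ≢inject₁ e)

greatestWitness : ∀ {n ℓ} {P : Pred (Fin n) ℓ} → Decidable P →
                  ∀ {p} → P p → ∃[ i ] (P i × (∀ {q} → i <ᶠ q → ¬ P q))
greatestWitness {P = P} P? {p} Pp = climb (>-wellFounded p) Pp
  where
  climb : ∀ {p} → Acc _>ᶠ_ p → P p → ∃[ i ] (P i × (∀ {q} → i <ᶠ q → ¬ P q))
  climb {p} (acc higher) Pp with FP.any? (λ q → (p FP.<? q) ×-dec P? q)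
  ... | yes (q , p<q , Pq) = climb (higher p<q) Pq
  ... | no none            = p , Pp , λ p<q Pq → none (_ , p<q , Pq)

module Chains {n : ℕ} (R : Rel (Fin n) 0ℓ) (R-trans : Transitive R) where

  singleton : ∀ i → ChainEndingAt R i 0
  singleton i = (λ _ → i) , (λ { Fin.zero Fin.zero () }) , refl

  extend : ∀ {j i m} → ChainEndingAt R j m → R j i → ChainEndingAt R i (suc m)
  extend {j} {i} {m} (s , chain , s-last) j≺i = s ∷ʳ i , chain′ , ∷ʳ-last s i
    where
    last≺i : R (s (fromℕ m)) i
    last≺i = subst (λ x → R x i) (sym s-last) j≺i

    below-i : ∀ p → R (s p) i
    below-i p with lastOrInject p
    ... | inj₁ refl       = last≺i
    ... | inj₂ (p′ , refl) = R-trans (chain _ _ (inject₁<fromℕ p′)) last≺i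

    chain′ : ∀ p q → p <ᶠ q → R ((s ∷ʳ i) p) ((s ∷ʳ i) q)
    chain′ p q p<q with lastOrInject p | lastOrInject q
    ... | inj₁ refl        | inj₁ refl        = ⊥-elim (FP.<-irrefl refl p<q)
    ... | inj₁ refl        | inj₂ (q′ , refl) = ⊥-elim (FP.<-asym p<q (inject₁<fromℕ q′))
    ... | inj₂ (p′ , refl) | inj₁ refl        = below-i p′
    ... | inj₂ (p′ , refl) | inj₂ (q′ , refl) = chain p′ q′ (inject₁-mono⁻¹ p<q)

  prefix : ∀ {i m} → ChainEndingAt R i (suc m) → ∃[ j ] (ChainEndingAt R j m × R j i)
  prefix {i} {m} (s , chain , s-last) =
    s (inject₁ (fromℕ m)) ,
    (s ∘ inject₁ , (λ p q p<q → chain _ _ (inject₁-mono p<q)) , refl) ,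
    subst (R _) s-last (chain _ _ (inject₁<fromℕ (fromℕ m)))

record IsGrading {n : ℕ} (R : Rel (Fin n) 0ℓ) (f : Fin n → ℕ) : Set where
  field
    positive    : ∀ i → ∃[ m ] f i ≡ suc m
    monotone    : ∀ {j i} → R j i → f j ℕ.< f i
    predecessor : ∀ {i k} → f i ≡ suc (suc k) → ∃[ j ] (R j i × f j ≡ suc k)

Longest : {n : ℕ} → Rel (Fin n) 0ℓ → (Fin n → ℕ) → Set
Longest R f = ∀ i → LongestEndingAt R i (f i)

module Gradings {n : ℕ} (R : Rel (Fin n) 0ℓ) (R-trans : Transitive R) where
  open Chains R R-trans

  longest⇒grading : ∀ {f} → Longest R f → IsGrading R f
  longest⇒grading {f} longest = record
    { positive = positive ; monotone = monotone ; predecessor = predecessor }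
    where
    bounded : ∀ {i m} → ChainEndingAt R i m → suc m ≤ f i
    bounded {i} c with longest i
    ... | (_ , fi , _ , maximal) = subst (_ ≤_) (sym fi) (s≤s (maximal _ c))

    positive : ∀ i → ∃[ m ] f i ≡ suc m
    positive i with longest i
    ... | (m , fi , _) = m , fi

    -- a longest chain at j extends to i
    monotone : ∀ {j i} → R j i → f j ℕ.< f i
    monotone {j} {i} j≺i with longest j
    ... | (_ , fj , cj , _) = subst (ℕ._< f i) (sym fj) (bounded (extend cj j≺i))

    -- the second-to-last point of a longest chain at i
    predecessor : ∀ {i k} → f i ≡ suc (suc k) → ∃[ j ] (R j i × f j ≡ suc k)
    predecessor {i} {k} fi with longest i
    ... | (m , fi′ , ci , _) with ℕP.suc-injective (trans (sym fi′) fi)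
    ... | refl with prefix ci
    ... | (j , cj , j≺i) =
      j , j≺i , ℕP.≤-antisym (ℕP.≤-pred (subst (f j ℕ.<_) fi (monotone j≺i))) (bounded cj)

  module _ {f : Fin n → ℕ} (grading : IsGrading R f) where
    open IsGrading grading

    reach : ∀ k i → f i ≡ suc k → ChainEndingAt R i k
    reach zero    i _  = singleton i
    reach (suc k) i fi with predecessor fi
    ... | (j , j≺i , fj) = extend (reach k j fj) j≺i

    -- f increases along every chain, so no chain at i has more than f i points
    bounded : ∀ {m i} → ChainEndingAt R i m → suc m ≤ f i
    bounded {zero}  {i} _ with positive i
    ... | (_ , fi) = subst (1 ≤_) (sym fi) (s≤s z≤n)
    bounded {suc m} c with prefix c
    ... | (j , cj , j≺i) = ℕP.≤-trans (s≤s (bounded cj)) (monotone j≺i)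

    grading⇒longest : Longest R f
    grading⇒longest i with positive i
    ... | (m , fi) = m , fi , reach m i fi ,
                     λ m′ c → ℕP.≤-pred (subst (suc m′ ≤_) fi (bounded c))

module Forcing {n : ℕ}
  (L : LinOrd n → Rel (Fin n) 0ℓ)
  (L-trans : ∀ ρ → Transitive (L ρ))
  (L-compare : ∀ ρ → Trichotomous _≡_ (L ρ))
  (f : Fin n → ℕ)
  (C : LinOrd n → Set)
  where

  Step : LinOrd n → Rel (Fin n) 0ℓ
  Step ρ j i = j <ᶠ i × L ρ j i

  Step-trans : ∀ ρ → Transitive (Step ρ)
  Step-trans ρ (a<b , a≺b) (b<c , b≺c) = FP.<-trans a<b b<c , L-trans ρ a≺b b≺c

  Forced : Rel (Fin n) 0ℓ
  Forced i j = ∀ ρ → C ρ → L ρ i j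

  module _ (C-longest : ∀ {ρ} → C ρ → Longest (Step ρ) f) where
    open IsGrading

    C-grading : ∀ {ρ} → C ρ → IsGrading (Step ρ) f
    C-grading {ρ} = Gradings.longest⇒grading (Step ρ) (Step-trans ρ) ∘ C-longest

    forced-down : ∀ {ρ} → C ρ → ∀ {j i} → j <ᶠ i → f i ≤ f j → L ρ i j
    forced-down {ρ} cρ {j} {i} j<i fi≤fj with L-compare ρ j i
    ... | tri< j≺i _ _ = ⊥-elim (ℕP.<⇒≱ (monotone (C-grading cρ) (j<i , j≺i)) fi≤fj)
    ... | tri≈ _ refl _ = ⊥-elim (FP.<-irrefl refl j<i)
    ... | tri> _ _ i≺j = i≺j

    -- the latest earlier position with value k+1 is forced below a position
    -- of value k+2: in each order of C some earlier position p of value k+1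
    -- lies below j, and p is either that latest position or forced above it
    forced-predecessor : ∀ {σ} → C σ → ∀ {j k} → f j ≡ suc (suc k) →
                         ∃[ i ] (i <ᶠ j × f i ≡ suc k × Forced i j)
    forced-predecessor cσ {j} {k} fj with predecessor (C-grading cσ) fj
    ... | (p , (p<j , _) , fp)
      with greatestWitness (λ q → (q FP.<? j) ×-dec (f q ℕP.≟ suc k)) (p<j , fp)
    ... | (i , (i<j , fi) , latest) = i , i<j , fi , below-j
      where
      below-j : Forced i j
      below-j ρ cρ with predecessor (C-grading cρ) fj
      ... | (p′ , (p′<j , p′≺j) , fp′) with FP.<-cmp p′ i
      ... | tri< p′<i _ _ =
        L-trans ρ (forced-down cρ p′<i (ℕP.≤-reflexive (trans fi (sym fp′)))) p′≺j
      ... | tri≈ _ refl _ = p′≺j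
      ... | tri> _ _ i<p′ = ⊥-elim (latest i<p′ (p′<j , fp′))

    extension-longest : ∀ {σ} → C σ → ∀ π → (∀ {i j} → Forced i j → L π i j) →
                        Longest (Step π) f
    extension-longest cσ π extends =
      Gradings.grading⇒longest (Step π) (Step-trans π) record
        { positive = positive (C-grading cσ) ; monotone = monotone′ ; predecessor = predecessor′ }
      where
      monotone′ : ∀ {j i} → Step π j i → f j ℕ.< f i
      monotone′ {j} {i} (j<i , j≺i) with f i ℕP.≤? f j
      ... | yes fi≤fj = ⊥-elim (tri⇒asym (L-compare π) j≺i
                                  (extends (λ ρ cρ → forced-down cρ j<i fi≤fj)))
      ... | no fi≰fj  = ℕP.≰⇒> fi≰fj

      predecessor′ : ∀ {j k} → f j ≡ suc (suc k) → ∃[ i ] (Step π i j × f i ≡ suc k)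
      predecessor′ fj with forced-predecessor cσ fj
      ... | (i , i<j , fi , forced) = i , (i<j , extends forced) , fi

<[]-trans : ∀ {n} (ρ : LinOrd n) → Transitive (_<[ ρ ]_)
<[]-trans ρ = FP.<-trans

<[]-compare : ∀ {n} (ρ : LinOrd n) → Trichotomous _≡_ (_<[ ρ ]_)
<[]-compare ρ a b with FP.<-cmp (ρ ⟨$⟩ʳ a) (ρ ⟨$⟩ʳ b)
... | tri< lt ¬eq ¬gt = tri< lt (¬eq ∘ cong (ρ ⟨$⟩ʳ_)) ¬gt
... | tri≈ ¬lt eq ¬gt = tri≈ ¬lt (Injection.injective (↔⇒↣ ρ) eq) ¬gt
... | tri> ¬lt ¬eq gt = tri> ¬lt (¬eq ∘ cong (ρ ⟨$⟩ʳ_)) gt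

theorem3 : (n : ℕ) (T : Tableau n) → IsEST T →
           (π : LinOrd n) →
           (InClass T π → IsLinearExtension T π) × (IsLinearExtension T π → InClass T π)
theorem3 n T (σ , σ∈T) π = forward , backward
  where
  -- increasing steps: L ρ = <_ρ;  decreasing steps: L ρ = its flip
  module Inc = Forcing (λ ρ → _<[ ρ ]_) <[]-trans <[]-compare (proj₁ ∘ T) (InClass T)
  module Dec = Forcing (λ ρ → flip _<[ ρ ]_) (λ ρ → Flip.trans (_<[ ρ ]_) (<[]-trans ρ))
                 (λ ρ → Flip.compare (_<[ ρ ]_) (<[]-compare ρ)) (proj₂ ∘ T) (InClass T)

  forward : InClass T π → IsLinearExtension T π
  forward π∈T i j i<Pj = i<Pj π π∈T

  backward : IsLinearExtension T π → InClass T π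
  backward extends i =
    Inc.extension-longest (λ ρ∈T → proj₁ ∘ ρ∈T) {σ} σ∈T π (extends _ _) i ,
    Dec.extension-longest (λ ρ∈T → proj₂ ∘ ρ∈T) {σ} σ∈T π (extends _ _) i
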